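{- Let $B=5$, let $\tilde p\neq0$ be an integer and $\tilde q$ a positive integer with $\tilde q\geqslant 3600\sqrt[3]{|\tilde p|}$. Let $F_1=B^{2}\tilde q^{6}+2B\tilde q^{4}-2B\tilde p\tilde q^{3}-2\tilde q^{2}-2\tilde p\tilde q+\tilde p^{2}+\frac5B-\frac{20}{B^{2}\tilde q^{2}}$, and consider the set of real $t$ with $F_1+\frac{10\tilde p}{B^{2}\tilde q^{3}}<t<F_1$ if $\tilde p<0$, respectively $F_1<t<F_1+\frac{10\tilde p}{B^{2}\tilde q^{3}}$ if $\tilde p>0$. This set contains at most one integer; an integer can occur only when $\tilde p>0$, and then it is $t=25\tilde q^{6}+10\tilde q^{4}-10\tilde p\tilde q^{3}-2\tilde q^{2}-2\tilde p\tilde q+\tilde p^{2}+1$. -}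

module Defs where

open import Data.Nat as ℕ using (ℕ; NonZero)
open import Data.Nat.Properties using (m*n≢0; m^n≢0)
open import Data.Integer as ℤ using (ℤ; +_)
open import Data.Rational as ℚ using (ℚ; _/_; _+_; _-_; _*_; _<_)
open import Data.Product using (_×_)

B : ℕ
B = 5

ι : ℤ → ℚ
ι z = z / 1

F₁ : (p : ℤ) (q : ℕ) → .{{NonZero q}} → ℚ
F₁ p q =
  ι (+ (B ℕ.^ 2 ℕ.* q ℕ.^ 6))
  + ι (+ (2 ℕ.* B ℕ.* q ℕ.^ 4))
  - ι (+ 2 ℤ.* + B ℤ.* p ℤ.* + (q ℕ.^ 3))
  - ι (+ (2 ℕ.* q ℕ.^ 2))
  - ι (+ 2 ℤ.* p ℤ.* + q)
  + ι (p ℤ.* p)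
  + (+ 5 / B)
  - ((+ 20 / (B ℕ.^ 2 ℕ.* q ℕ.^ 2)) {{m*n≢0 (B ℕ.^ 2) (q ℕ.^ 2) {{m^n≢0 B 2}} {{m^n≢0 q 2}}}})

δ : (p : ℤ) (q : ℕ) → .{{NonZero q}} → ℚ
δ p q = ((+ 10 ℤ.* p) / (B ℕ.^ 2 ℕ.* q ℕ.^ 3))
          {{m*n≢0 (B ℕ.^ 2) (q ℕ.^ 3) {{m^n≢0 B 2}} {{m^n≢0 q 3}}}}

-- the set of real t described in the paper (for p ≠ 0), membership of a rational t:
-- F₁ + δ < t < F₁ if p < 0, and F₁ < t < F₁ + δ if p > 0
InSet : (p : ℤ) (q : ℕ) → .{{NonZero q}} → ℚ → Set
InSet p q t with p
... | ℤ.+ 0 = ⊥′ where open import Data.Empty using () renaming (⊥ to ⊥′)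
... | ℤ.+ (ℕ.suc _) = (F₁ p q < t) × (t < F₁ p q + δ p q)
... | ℤ.-[1+ _ ] = (F₁ p q + δ p q < t) × (t < F₁ p q)

N : ℤ → ℕ → ℤ
N p q = + (25 ℕ.* q ℕ.^ 6) ℤ.+ + (10 ℕ.* q ℕ.^ 4) ℤ.- + 10 ℤ.* p ℤ.* + (q ℕ.^ 3)
        ℤ.- + (2 ℕ.* q ℕ.^ 2) ℤ.- + 2 ℤ.* p ℤ.* + q ℤ.+ p ℤ.* p ℤ.+ + 1

-- Since 5/B = 1, F₁ = N − ε with ε = 20/(25q²) ∈ [0, 4/5], and the hypothesis gives
-- |δ| ≤ 1/5 for δ = 10p/(25q³). For p > 0 the set therefore lies strictly between
-- N − 1 and N + 1, so its only possible integer is N; for p < 0 it lies strictly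
-- between N − 1 and N and contains no integer.
module Submission where

open import Defs
open import Data.Nat as ℕ using (ℕ; NonZero; suc)
import Data.Nat.Properties as ℕP
open import Data.Integer as ℤ using (ℤ; +_; ∣_∣)
import Data.Integer.Properties as ℤP
open import Data.Integer.Solver using (module +-*-Solver)
open import Data.Rational using (ℚ; _/_; _+_; _-_; -_; _≤_; _<_; 0ℚ; 1ℚ; toℚᵘ)
import Data.Rational.Properties as ℚP
import Data.Rational.Unnormalised as ℚᵘ
import Data.Rational.Unnormalised.Properties as ℚᵘP
open import Data.Product using (_×_; _,_; proj₂)
open import Data.Empty using (⊥-elim)
open import Relation.Nullary.Decidable using (from-yes)
open import Relation.Binary.PropositionalEquality

open +-*-Solver

toℚᵘ-/ : ∀ i n .{{_ : NonZero n}} → toℚᵘ (i / n) ℚᵘ.≃ i ℚᵘ./ n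
toℚᵘ-/ i (suc m) = ℚP.toℚᵘ-fromℚᵘ (i ℚᵘ./ suc m)

*≤*⇒/≤/ : ∀ i m j n .{{_ : NonZero m}} .{{_ : NonZero n}} →
          i ℤ.* + n ℤ.≤ j ℤ.* + m → i / m ≤ j / n
*≤*⇒/≤/ i m@(suc _) j n@(suc _) i*n≤j*m = ℚP.toℚᵘ-cancel-≤
  (ℚᵘP.≤-respˡ-≃ (ℚᵘP.≃-sym (toℚᵘ-/ i m))
  (ℚᵘP.≤-respʳ-≃ (ℚᵘP.≃-sym (toℚᵘ-/ j n)) (ℚᵘ.*≤* i*n≤j*m)))

ι-homo-+ : ∀ i j → ι (i ℤ.+ j) ≡ ι i + ι j
ι-homo-+ i j = ℚP.toℚᵘ-injective (begin
  toℚᵘ (ι (i ℤ.+ j))                ≈⟨ toℚᵘ-/ (i ℤ.+ j) 1 ⟩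
  (i ℤ.+ j) ℚᵘ./ 1                  ≈⟨ ℚᵘ.*≡* (solve 2 (λ i j → (i :+ j) :* con (+ 1)
                                         := (i :* con (+ 1) :+ j :* con (+ 1)) :* con (+ 1)) refl i j) ⟩
  (i ℚᵘ./ 1) ℚᵘ.+ (j ℚᵘ./ 1)        ≈⟨ ℚᵘP.+-cong (toℚᵘ-/ i 1) (toℚᵘ-/ j 1) ⟨
  toℚᵘ (ι i) ℚᵘ.+ toℚᵘ (ι j)        ≈⟨ ℚP.toℚᵘ-homo-+ (ι i) (ι j) ⟨
  toℚᵘ (ι i + ι j)                  ∎)
  where open ℚᵘP.≃-Reasoning

ι-homo‿- : ∀ i → ι (ℤ.- i) ≡ - ι i
ι-homo‿- i = ℚP.toℚᵘ-injective (begin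
  toℚᵘ (ι (ℤ.- i))      ≈⟨ toℚᵘ-/ (ℤ.- i) 1 ⟩
  ℚᵘ.- (i ℚᵘ./ 1)       ≈⟨ ℚᵘP.-‿cong (toℚᵘ-/ i 1) ⟨
  ℚᵘ.- toℚᵘ (ι i)       ≈⟨ ℚP.toℚᵘ-homo‿- (ι i) ⟨
  toℚᵘ (- ι i)          ∎)
  where open ℚᵘP.≃-Reasoning

ι-homo-- : ∀ i j → ι (i ℤ.- j) ≡ ι i - ι j
ι-homo-- i j = trans (ι-homo-+ i (ℤ.- j)) (cong (λ z → ι i + z) (ι-homo‿- j))

ι-cancel-< : ∀ {i j} → ι i < ι j → i ℤ.< j
ι-cancel-< {i} {j} ιi<ιj
  with ℚᵘP.<-respˡ-≃ (toℚᵘ-/ i 1) (ℚᵘP.<-respʳ-≃ (toℚᵘ-/ j 1) (ℚP.toℚᵘ-mono-< ιi<ιj))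
... | ℚᵘ.*<* i*1<j*1 = subst₂ ℤ._<_ (ℤP.*-identityʳ i) (ℤP.*-identityʳ j) i*1<j*1

ι-pred : ∀ n → ι (ℤ.pred n) ≡ ι n - 1ℚ
ι-pred n = trans (ι-homo-+ ℤ.-1ℤ n) (ℚP.+-comm (ι ℤ.-1ℤ) (ι n))

ι-suc : ∀ n → ι (ℤ.suc n) ≡ ι n + 1ℚ
ι-suc n = trans (ι-homo-+ ℤ.1ℤ n) (ℚP.+-comm (ι ℤ.1ℤ) (ι n))

module _ {x : ℚ} (n t : ℤ) where

  ι+offset<ι⇒≤ : - 1ℚ ≤ x → ι n + x < ι t → n ℤ.≤ t
  ι+offset<ι⇒≤ -1≤x ιn+x<ιt = subst (ℤ._≤ t) (ℤP.suc-pred n) (ℤP.i<j⇒suc[i]≤j (ι-cancel-< {ℤ.pred n} (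
    ℚP.≤-<-trans (subst (_≤ ι n + x) (sym (ι-pred n)) (ℚP.+-monoʳ-≤ (ι n) -1≤x)) ιn+x<ιt)))

  ι<ι+offset⇒≤ : x ≤ 1ℚ → ι t < ι n + x → t ℤ.≤ n
  ι<ι+offset⇒≤ x≤1 ιt<ιn+x = subst (t ℤ.≤_) (ℤP.pred-suc n) (ℤP.i<j⇒i≤pred[j] (ι-cancel-< {j = ℤ.suc n} (
    ℚP.<-≤-trans ιt<ιn+x (subst (ι n + x ≤_) (sym (ι-suc n)) (ℚP.+-monoʳ-≤ (ι n) x≤1)))))

  ι<ι+offset⇒< : x ≤ 0ℚ → ι t < ι n + x → t ℤ.< n
  ι<ι+offset⇒< x≤0 ιt<ιn+x = ι-cancel-< {t} {n} (
    ℚP.<-≤-trans ιt<ιn+x (subst (ι n + x ≤_) (ℚP.+-identityʳ (ι n)) (ℚP.+-monoʳ-≤ (ι n) x≤0)))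

module _ (q : ℕ) .{{_ : NonZero q}} where

  private instance
    25q²≢0 : NonZero (B ℕ.^ 2 ℕ.* q ℕ.^ 2)
    25q²≢0 = ℕP.m*n≢0 (B ℕ.^ 2) (q ℕ.^ 2) {{ℕP.m^n≢0 B 2}} {{ℕP.m^n≢0 q 2}}

  ε : ℚ
  ε = + 20 / (B ℕ.^ 2 ℕ.* q ℕ.^ 2)

  0≤ε : 0ℚ ≤ ε
  0≤ε = *≤*⇒/≤/ (+ 0) 1 (+ 20) (B ℕ.^ 2 ℕ.* q ℕ.^ 2) (ℤ.+≤+ ℕ.z≤n)

  ε≤4/5 : ε ≤ + 4 / 5
  ε≤4/5 = *≤*⇒/≤/ (+ 20) (B ℕ.^ 2 ℕ.* q ℕ.^ 2) (+ 4) 5 (begin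
    + 20 ℤ.* + 5                       ≡⟨⟩
    + (100 ℕ.* 1)                      ≤⟨ ℤ.+≤+ (ℕP.*-monoʳ-≤ 100 (ℕ.>-nonZero⁻¹ (q ℕ.^ 2) {{ℕP.m^n≢0 q 2}})) ⟩
    + (100 ℕ.* q ℕ.^ 2)                ≡⟨ cong +_ (ℕP.*-assoc 4 (B ℕ.^ 2) (q ℕ.^ 2)) ⟩
    + (4 ℕ.* (B ℕ.^ 2 ℕ.* q ℕ.^ 2))    ≡⟨ ℤP.pos-* 4 (B ℕ.^ 2 ℕ.* q ℕ.^ 2) ⟩
    + 4 ℤ.* + (B ℕ.^ 2 ℕ.* q ℕ.^ 2)    ∎)
    where open ℤP.≤-Reasoning

  -ε≤0 : - ε ≤ 0ℚ
  -ε≤0 = ℚP.neg-antimono-≤ 0≤ε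

  -1≤-ε : - 1ℚ ≤ - ε
  -1≤-ε = ℚP.neg-antimono-≤ (ℚP.≤-trans ε≤4/5 (from-yes (+ 4 / 5 ℚP.≤? 1ℚ)))

-- The summands of N are those of F₁ once B = 5 is evaluated (in particular 5/B = 1ℚ).
F₁≡ι[N]-ε : ∀ p q .{{_ : NonZero q}} → F₁ p q ≡ ι (N p q) - ε q
F₁≡ι[N]-ε p q = cong (_- ε q) (sym (begin
  ι (a ℤ.+ b ℤ.- c ℤ.- d ℤ.- e ℤ.+ f ℤ.+ + 1)     ≡⟨ ι-homo-+ (a ℤ.+ b ℤ.- c ℤ.- d ℤ.- e ℤ.+ f) (+ 1) ⟩
  ι (a ℤ.+ b ℤ.- c ℤ.- d ℤ.- e ℤ.+ f) + 1ℚ       ≡⟨ cong (_+ 1ℚ) (ι-homo-+ (a ℤ.+ b ℤ.- c ℤ.- d ℤ.- e) f) ⟩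
  ι (a ℤ.+ b ℤ.- c ℤ.- d ℤ.- e) + ι f + 1ℚ       ≡⟨ cong (λ z → z + ι f + 1ℚ) (ι-homo-- (a ℤ.+ b ℤ.- c ℤ.- d) e) ⟩
  ι (a ℤ.+ b ℤ.- c ℤ.- d) - ι e + ι f + 1ℚ       ≡⟨ cong (λ z → z - ι e + ι f + 1ℚ) (ι-homo-- (a ℤ.+ b ℤ.- c) d) ⟩
  ι (a ℤ.+ b ℤ.- c) - ι d - ι e + ι f + 1ℚ       ≡⟨ cong (λ z → z - ι d - ι e + ι f + 1ℚ) (ι-homo-- (a ℤ.+ b) c) ⟩
  ι (a ℤ.+ b) - ι c - ι d - ι e + ι f + 1ℚ       ≡⟨ cong (λ z → z - ι c - ι d - ι e + ι f + 1ℚ) (ι-homo-+ a b) ⟩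
  ι a + ι b - ι c - ι d - ι e + ι f + 1ℚ         ∎))
  where
  open ≡-Reasoning
  a = + (B ℕ.^ 2 ℕ.* q ℕ.^ 6)
  b = + (2 ℕ.* B ℕ.* q ℕ.^ 4)
  c = + 2 ℤ.* + B ℤ.* p ℤ.* + (q ℕ.^ 3)
  d = + (2 ℕ.* q ℕ.^ 2)
  e = + 2 ℤ.* p ℤ.* + q
  f = p ℤ.* p

F₁+δ≡ι[N]+[-ε+δ] : ∀ p q .{{_ : NonZero q}} → F₁ p q + δ p q ≡ ι (N p q) + (- ε q + δ p q)
F₁+δ≡ι[N]+[-ε+δ] p q = trans (cong (_+ δ p q) (F₁≡ι[N]-ε p q)) (ℚP.+-assoc (ι (N p q)) (- ε q) (δ p q))

module _ (u q : ℕ) .{{_ : NonZero q}} (2u≤q³ : 2 ℕ.* u ℕ.≤ q ℕ.^ 3) where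

  private
    instance
      25q³≢0 : NonZero (B ℕ.^ 2 ℕ.* q ℕ.^ 3)
      25q³≢0 = ℕP.m*n≢0 (B ℕ.^ 2) (q ℕ.^ 3) {{ℕP.m^n≢0 B 2}} {{ℕP.m^n≢0 q 3}}

    50u≤25q³ : (+ 10 ℤ.* + u) ℤ.* + 5 ℤ.≤ + (B ℕ.^ 2 ℕ.* q ℕ.^ 3)
    50u≤25q³ = begin
      (+ 10 ℤ.* + u) ℤ.* + 5   ≡⟨ solve 1 (λ u → (con (+ 10) :* u) :* con (+ 5) := con (+ 25) :* (con (+ 2) :* u)) refl (+ u) ⟩
      + 25 ℤ.* (+ 2 ℤ.* + u)   ≡⟨ cong (+ 25 ℤ.*_) (ℤP.pos-* 2 u) ⟨
      + 25 ℤ.* + (2 ℕ.* u)     ≤⟨ ℤP.*-monoˡ-≤-nonNeg (+ 25) (ℤ.+≤+ 2u≤q³) ⟩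
      + 25 ℤ.* + (q ℕ.^ 3)     ≡⟨ ℤP.pos-* 25 (q ℕ.^ 3) ⟨
      + (B ℕ.^ 2 ℕ.* q ℕ.^ 3)  ∎
      where open ℤP.≤-Reasoning

  δ≤1/5 : δ (+ u) q ≤ + 1 / 5
  δ≤1/5 = *≤*⇒/≤/ (+ 10 ℤ.* + u) (B ℕ.^ 2 ℕ.* q ℕ.^ 3) (+ 1) 5
    (subst (_ ℤ.≤_) (sym (ℤP.*-identityˡ _)) 50u≤25q³)

  -1/5≤δ : - (+ 1 / 5) ≤ δ (ℤ.- + u) q
  -1/5≤δ = *≤*⇒/≤/ ℤ.-1ℤ 5 (+ 10 ℤ.* ℤ.- + u) (B ℕ.^ 2 ℕ.* q ℕ.^ 3)
    (subst₂ ℤ._≤_ (sym (ℤP.-1*i≡-i _))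
      (solve 1 (λ u → :- ((con (+ 10) :* u) :* con (+ 5)) := (con (+ 10) :* (:- u)) :* con (+ 5)) refl (+ u))
      (ℤP.neg-mono-≤ 50u≤25q³))

  -ε+δ≤1 : - ε q + δ (+ u) q ≤ 1ℚ
  -ε+δ≤1 = ℚP.≤-trans (ℚP.+-mono-≤ (-ε≤0 q) δ≤1/5) (from-yes (+ 1 / 5 ℚP.≤? 1ℚ))

  -1≤-ε+δ : - 1ℚ ≤ - ε q + δ (ℤ.- + u) q
  -1≤-ε+δ = ℚP.+-mono-≤ (ℚP.neg-antimono-≤ (ε≤4/5 q)) -1/5≤δ

2∣p∣≤q³ : ∀ p q → 3600 ℕ.^ 3 ℕ.* ∣ p ∣ ℕ.≤ q ℕ.^ 3 → 2 ℕ.* ∣ p ∣ ℕ.≤ q ℕ.^ 3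
2∣p∣≤q³ p q = ℕP.≤-trans (ℕP.*-monoˡ-≤ ∣ p ∣ (from-yes (2 ℕ.≤? 3600 ℕ.^ 3)))

ι∈InSet⇒0<p×≡N : ∀ p q .{{_ : NonZero q}} → 2 ℕ.* ∣ p ∣ ℕ.≤ q ℕ.^ 3 →
                  ∀ t → InSet p q (ι t) → (+ 0 ℤ.< p) × (t ≡ N p q)
ι∈InSet⇒0<p×≡N (+ 0) q _ t ()
ι∈InSet⇒0<p×≡N p@(+ suc u) q 2∣p∣≤q³ t (F₁<ιt , ιt<F₁+δ) = ℤ.+<+ ℕ.z<s , ℤP.≤-antisym
  (ι<ι+offset⇒≤ (N p q) t (-ε+δ≤1 (suc u) q 2∣p∣≤q³) (subst (ι t <_) (F₁+δ≡ι[N]+[-ε+δ] p q) ιt<F₁+δ))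
  (ι+offset<ι⇒≤ (N p q) t (-1≤-ε q) (subst (_< ι t) (F₁≡ι[N]-ε p q) F₁<ιt))
ι∈InSet⇒0<p×≡N p@(ℤ.-[1+ u ]) q 2∣p∣≤q³ t (F₁+δ<ιt , ιt<F₁) = ⊥-elim (ℤP.<⇒≱
  (ι<ι+offset⇒< {x = - ε q} (N p q) t (-ε≤0 q) (subst (ι t <_) (F₁≡ι[N]-ε p q) ιt<F₁))
  (ι+offset<ι⇒≤ (N p q) t (-1≤-ε+δ (suc u) q 2∣p∣≤q³) (subst (_< ι t) (F₁+δ≡ι[N]+[-ε+δ] p q) F₁+δ<ιt)))

theorem7p4 : (p : ℤ) (q : ℕ) .{{_ : NonZero q}} → p ≢ + 0
    → 3600 ℕ.^ 3 ℕ.* ∣ p ∣ ℕ.≤ q ℕ.^ 3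
    → (∀ (t s : ℤ) → InSet p q (ι t) → InSet p q (ι s) → t ≡ s)
      × (∀ (t : ℤ) → InSet p q (ι t) → (+ 0 ℤ.< p) × (t ≡ N p q))
theorem7p4 p q _ hyp = (λ t s t∈ s∈ → trans (t≡N t t∈) (sym (t≡N s s∈))) , in-set
  where
  in-set : ∀ t → InSet p q (ι t) → (+ 0 ℤ.< p) × (t ≡ N p q)
  in-set = ι∈InSet⇒0<p×≡N p q (2∣p∣≤q³ p q hyp)

  t≡N : ∀ t → InSet p q (ι t) → t ≡ N p q
  t≡N t t∈ = proj₂ (in-set t t∈)
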